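{- The following games are realizable as monotone set coloring games: (a) $\{\top\mid a\}$ and (b) $\{a\mid\bot\}$, over $P_3$; (c) $\{\{\top\mid a\},\{\top\mid b\}\mid\{a\mid\bot\},\{b\mid\bot\}\}$ and (d) $\{a,\{\top\mid b\}\mid\{a\mid\bot\},b\}$, over $P_4$.
   Context: $P_3=\{\bot<a<\top\}$; $P_4=\{\top,a,b,\bot\}$ with $\top$ top, $\bot$ bottom, $a,b$ incomparable. Games over a poset $C$: atomic $[x]$ ($x\in C$) with no options, or composite $\{L\mid R\}$ with non-empty sets of left and right options; inside braces an atom $x$ stands for $[x]$. $\le$ and $\lhd$ by mutual recursion: $G\le H$ iff every left option $G^L$ satisfies $G^L\lhd H$, every right option $H^R$ satisfies $G\lhd H^R$, and if $G$ or $H$ is atomic then $G\lhd H$; $G\lhd H$ iff some $G^R\le H$, or $G\le$ some $H^L$, or $G=[x],H=[y]$ with $x\le y$; $G\equiv H$ iff $G\le H$ and $H\le G$. A monotone set coloring game $S$ over $C$ is a pair $(|S|,\phi_S)$ with $|S|$ a finite set of cells and $\phi_S:\{\bot,\top\}^{|S|}\to C$ monotone (pointwise order). Positions are maps $p:|S|\to\{\top,\bot,\star\}$, atomic if no $\star$. $[\![p]\!]=[\phi_S(p)]$ if $p$ is atomic, else $\{[\![p^L]\!]\mid[\![p^R]\!]\}$ where $p^L$ (resp. $p^R$) ranges over positions obtained by changing one $\star$-cell to $\top$ (resp. $\bot$); $[\![S]\!]$ is $[\![\cdot]\!]$ of the all-$\star$ position. $G$ is realizable if $G\equiv[\![S]\!]$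 for some such $S$ over the same poset. -}

module Defs where

open import Data.Bool using (Bool; true; false) renaming (_≤_ to _≤B_)
open import Data.Nat using (ℕ; zero; suc)
open import Data.Fin using (Fin)
open import Data.Fin.Properties using (_≟_)
open import Data.List using (List; []; _∷_; filter; map; allFin)
open import Data.List.NonEmpty using (List⁺; _∷_; toList) renaming (map to map⁺)
open import Data.List.Membership.Propositional using (_∈_)
open import Data.Product using (Σ; _×_; _,_)
open import Relation.Nullary using (yes; no)
open import Relation.Binary.PropositionalEquality using (_≡_)

data Game (C : Set) : Set where
  [_]   : C → Game C
  ⟨_∣_⟩ : List⁺ (Game C) → List⁺ (Game C) → Game C

module GameOrder {C : Set} (_≼_ : C → C → Set) where

  _∈ᴸ_ : Game C → Game C → Set
  X ∈ᴸ [ x ]     = Data.Empty.⊥ where import Data.Empty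
  X ∈ᴸ ⟨ L ∣ R ⟩ = X ∈ toList L

  _∈ᴿ_ : Game C → Game C → Set
  X ∈ᴿ [ x ]     = Data.Empty.⊥ where import Data.Empty
  X ∈ᴿ ⟨ L ∣ R ⟩ = X ∈ toList R

  data Atomic : Game C → Set where
    atomic : (x : C) → Atomic [ x ]

  data _≤G_ : Game C → Game C → Set
  data _◁_  : Game C → Game C → Set

  data _≤G_ where
    le : {G H : Game C} →
         (∀ GL → GL ∈ᴸ G → GL ◁ H) →
         (∀ HR → HR ∈ᴿ H → G ◁ HR) →
         (Atomic G → G ◁ H) →
         (Atomic H → G ◁ H) →
         G ≤G H

  data _◁_ where
    ◁-right : {G H GR : Game C} → GR ∈ᴿ G → GR ≤G H → G ◁ H
    ◁-left  : {G H HL : Game C} → HL ∈ᴸ H → G ≤G HL → G ◁ H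
    ◁-atom  : {x y : C} → x ≼ y → [ x ] ◁ [ y ]

  _≡G_ : Game C → Game C → Set
  G ≡G H = (G ≤G H) × (H ≤G G)

data Cell : Set where
  ⊤c ⊥c ⋆c : Cell

Position : ℕ → Set
Position n = Fin n → Cell

-- colorings {⊥,⊤}^n, with false = ⊥, true = ⊤
Coloring : ℕ → Set
Coloring n = Fin n → Bool

Monotone : {C : Set} (_≼_ : C → C → Set) {n : ℕ} → (Coloring n → C) → Set
Monotone _≼_ {n} φ = (f g : Coloring n) → (∀ i → f i ≤B g i) → φ f ≼ φ g

isStar : Cell → Bool
isStar ⋆c = true
isStar _  = false

starCells : {n : ℕ} → Position n → List (Fin n)
starCells {n} p = filter (λ i → Data.Bool._≟_ (isStar (p i)) true) (allFin n)
  where import Data.Bool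

-- the coloring of an atomic position (⋆ never occurs when it is used)
toColoring : {n : ℕ} → Position n → Coloring n
toColoring p i with p i
... | ⊤c = true
... | _  = false

set : {n : ℕ} → Position n → Fin n → Cell → Position n
set p i c j with i ≟ j
... | yes _ = c
... | no  _ = p j

-- ⟦ p ⟧ computed with fuel k; each move removes one ⋆, so fuel n
-- (the number of cells) suffices starting from any position.
evalPos : {C : Set} {n : ℕ} → (Coloring n → C) → ℕ → Position n → Game C
evalPos φ k p with starCells p
evalPos φ k       p | []     = [ φ (toColoring p) ]
evalPos φ zero    p | _ ∷ _  = [ φ (toColoring p) ]   -- unreachable with fuel n
evalPos φ (suc k) p | i ∷ is =
  ⟨ map⁺ (λ j → evalPos φ k (set p j ⊤c)) (i ∷ is)
  ∣ map⁺ (λ j → evalPos φ k (set p j ⊥c)) (i ∷ is) ⟩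

allStar : {n : ℕ} → Position n
allStar _ = ⋆c

⟦_,_⟧ : {C : Set} (n : ℕ) → (Coloring n → C) → Game C
⟦ n , φ ⟧ = evalPos φ n allStar

Realizable : {C : Set} (_≼_ : C → C → Set) → Game C → Set
Realizable {C} _≼_ G =
  Σ ℕ λ n → Σ (Coloring n → C) λ φ → Monotone _≼_ φ × (G ≡G ⟦ n , φ ⟧)
  where open GameOrder _≼_

data P3 : Set where
  ⊥₃ a₃ ⊤₃ : P3

data _≤₃_ : P3 → P3 → Set where
  ⊥≤a : ⊥₃ ≤₃ a₃
  ⊥≤⊤ : ⊥₃ ≤₃ ⊤₃
  a≤⊤ : a₃ ≤₃ ⊤₃
  refl₃ : {x : P3} → x ≤₃ x

data P4 : Set where
  ⊥₄ a₄ b₄ ⊤₄ : P4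

data _≤₄_ : P4 → P4 → Set where
  ⊥≤ : {x : P4} → ⊥₄ ≤₄ x
  ≤⊤ : {x : P4} → x ≤₄ ⊤₄
  refl₄ : {x : P4} → x ≤₄ x

gameA : Game P3
gameA = ⟨ [ ⊤₃ ] ∷ [] ∣ [ a₃ ] ∷ [] ⟩

gameB : Game P3
gameB = ⟨ [ a₃ ] ∷ [] ∣ [ ⊥₃ ] ∷ [] ⟩

gameC : Game P4
gameC = ⟨ ⟨ [ ⊤₄ ] ∷ [] ∣ [ a₄ ] ∷ [] ⟩ ∷ ⟨ [ ⊤₄ ] ∷ [] ∣ [ b₄ ] ∷ [] ⟩ ∷ []
        ∣ ⟨ [ a₄ ] ∷ [] ∣ [ ⊥₄ ] ∷ [] ⟩ ∷ ⟨ [ b₄ ] ∷ [] ∣ [ ⊥₄ ] ∷ [] ⟩ ∷ [] ⟩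

gameD : Game P4
gameD = ⟨ [ a₄ ] ∷ ⟨ [ ⊤₄ ] ∷ [] ∣ [ b₄ ] ∷ [] ⟩ ∷ []
        ∣ ⟨ [ a₄ ] ∷ [] ∣ [ ⊥₄ ] ∷ [] ⟩ ∷ [ b₄ ] ∷ [] ⟩

-- Both order relations on games over a decidable poset are decidable, by a recursion
-- that is lexicographic in the pair of games. Realizability of a concrete game G is then
-- a matter of exhibiting a monotone coloring φ and letting the decision procedure confirm
-- G ≡ ⟦ n , φ ⟧. For (a), (b) one cell suffices. Over P4 ≅ {⊥,⊤}² a monotone coloring is
-- a pair of monotone Boolean functions, which we write as positive DNFs: for (c) each of
-- two cells sets one coordinate; (d) needs five cells.
module Submission where

open import Defs
open import Data.Bool using (Bool; true; false; _∧_; _∨_; if_then_else_; b≤b) renaming (_≤_ to _≤B_)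
open import Data.Bool.Properties using (≤-minimum; ≤-maximum)
open import Data.Bool.ListAction using (any; all)
open import Data.Empty using (⊥)
open import Data.Fin using (Fin; zero)
open import Data.Fin.Patterns using (0F; 1F; 2F; 3F; 4F)
open import Data.List using (List; []; _∷_)
open import Data.List.NonEmpty using (_∷_; toList)
open import Data.List.Membership.Propositional using (find; lose)
open import Data.List.Relation.Unary.All as All using (All; []; _∷_)
open import Data.List.Relation.Unary.Any as Any using (Any)
open import Data.Nat using (ℕ)
open import Data.Product using (∃; _×_; _,_)
open import Data.Sum as Sum using (_⊎_; inj₁; inj₂)
open import Function using (_∘_; _⇔_; mk⇔; Equivalence)
open import Relation.Binary.Definitions using (Decidable; Reflexive)
open import Relation.Nullary using (Dec; yes; no)
open import Relation.Nullary.Decidable using (True; toWitness; map; map′; _×-dec_; _⊎-dec_; _→-dec_)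

leftOptions rightOptions : {C : Set} → Game C → List (Game C)
leftOptions [ _ ]     = []
leftOptions ⟨ L ∣ _ ⟩ = toList L
rightOptions [ _ ]     = []
rightOptions ⟨ _ ∣ R ⟩ = toList R

module GameOrderDecidable {C : Set} {_≼_ : C → C → Set} (_≼?_ : Decidable _≼_) where
  open GameOrder _≼_

  AtomsOrdered : Game C → Game C → Set
  AtomsOrdered [ x ] [ y ] = x ≼ y
  AtomsOrdered _     _     = ⊥

  ∀∈ᴸ⇔All : ∀ {P : Game C → Set} G → (∀ X → X ∈ᴸ G → P X) ⇔ All P (leftOptions G)
  ∀∈ᴸ⇔All [ _ ]     = mk⇔ (λ _ → []) (λ _ _ ())
  ∀∈ᴸ⇔All ⟨ _ ∣ _ ⟩ = mk⇔ (λ f → All.tabulate (f _)) (λ ps _ → All.lookup ps)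

  ∀∈ᴿ⇔All : ∀ {P : Game C → Set} G → (∀ X → X ∈ᴿ G → P X) ⇔ All P (rightOptions G)
  ∀∈ᴿ⇔All [ _ ]     = mk⇔ (λ _ → []) (λ _ _ ())
  ∀∈ᴿ⇔All ⟨ _ ∣ _ ⟩ = mk⇔ (λ f → All.tabulate (f _)) (λ ps _ → All.lookup ps)

  ∃∈ᴸ⇔Any : ∀ {P : Game C → Set} G → (∃ λ X → X ∈ᴸ G × P X) ⇔ Any P (leftOptions G)
  ∃∈ᴸ⇔Any [ _ ]     = mk⇔ (λ ()) (λ ())
  ∃∈ᴸ⇔Any ⟨ _ ∣ _ ⟩ = mk⇔ (λ (_ , m , p) → lose m p) find

  ∃∈ᴿ⇔Any : ∀ {P : Game C → Set} G → (∃ λ X → X ∈ᴿ G × P X) ⇔ Any P (rightOptions G)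
  ∃∈ᴿ⇔Any [ _ ]     = mk⇔ (λ ()) (λ ())
  ∃∈ᴿ⇔Any ⟨ _ ∣ _ ⟩ = mk⇔ (λ (_ , m , p) → lose m p) find

  ≤G-Unfolded ◁-Unfolded : Game C → Game C → Set
  ≤G-Unfolded G H =
    All (_◁ H) (leftOptions G) × All (G ◁_) (rightOptions H) × (Atomic G ⊎ Atomic H → G ◁ H)
  ◁-Unfolded G H =
    Any (_≤G H) (rightOptions G) ⊎ Any (G ≤G_) (leftOptions H) ⊎ AtomsOrdered G H

  ≤G-unfolding : ∀ G H → ≤G-Unfolded G H ⇔ G ≤G H
  ≤G-unfolding G H = mk⇔ intro elim
    where
    open Equivalence
    intro : ≤G-Unfolded G H → G ≤G H
    intro (ls , rs , a) = le (from (∀∈ᴸ⇔All G) ls) (from (∀∈ᴿ⇔All H) rs) (a ∘ inj₁) (a ∘ inj₂)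
    elim : G ≤G H → ≤G-Unfolded G H
    elim (le ls rs aG aH) = to (∀∈ᴸ⇔All G) ls , to (∀∈ᴿ⇔All H) rs , Sum.[ aG , aH ]

  atomsOrdered⇒◁ : ∀ G H → AtomsOrdered G H → G ◁ H
  atomsOrdered⇒◁ [ _ ] [ _ ] = ◁-atom

  ◁-unfolding : ∀ G H → ◁-Unfolded G H ⇔ G ◁ H
  ◁-unfolding G H = mk⇔ intro elim
    where
    open Equivalence
    intro : ◁-Unfolded G H → G ◁ H
    intro (inj₁ r)        = let (_ , m , p) = from (∃∈ᴿ⇔Any G) r in ◁-right m p
    intro (inj₂ (inj₁ l)) = let (_ , m , p) = from (∃∈ᴸ⇔Any H) l in ◁-left m p
    intro (inj₂ (inj₂ a)) = atomsOrdered⇒◁ G H a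
    elim : G ◁ H → ◁-Unfolded G H
    elim (◁-right m p) = inj₁ (to (∃∈ᴿ⇔Any G) (_ , m , p))
    elim (◁-left m p)  = inj₂ (inj₁ (to (∃∈ᴸ⇔Any H) (_ , m , p)))
    elim (◁-atom p)    = inj₂ (inj₂ p)

  -- Every call shrinks one game and keeps the other. The helpers take the head and tail
  -- of an option list separately, so that they are visibly subterms of the List⁺ pattern.
  _≤?_ : Decidable _≤G_
  _◁?_ : Decidable _◁_
  all◁? : ∀ G Gs H → Dec (All (_◁ H) (G ∷ Gs))
  all▷? : ∀ G H Hs → Dec (All (G ◁_) (H ∷ Hs))
  any≤? : ∀ G Gs H → Dec (Any (_≤G H) (G ∷ Gs))
  any≥? : ∀ G H Hs → Dec (Any (G ≤G_) (H ∷ Hs))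
  leftOptions◁? : ∀ G H → Dec (All (_◁ H) (leftOptions G))
  rightOptions▷? : ∀ G H → Dec (All (G ◁_) (rightOptions H))
  rightOptions≤? : ∀ G H → Dec (Any (_≤G H) (rightOptions G))
  leftOptions≥? : ∀ G H → Dec (Any (G ≤G_) (leftOptions H))

  atomic? : ∀ G → Dec (Atomic G)
  atomic? [ x ]     = yes (atomic x)
  atomic? ⟨ _ ∣ _ ⟩ = no λ ()

  atomsOrdered? : ∀ G H → Dec (AtomsOrdered G H)
  atomsOrdered? [ x ]     [ y ]     = x ≼? y
  atomsOrdered? [ _ ]     ⟨ _ ∣ _ ⟩ = no λ ()
  atomsOrdered? ⟨ _ ∣ _ ⟩ _         = no λ ()

  G ≤? H = map (≤G-unfolding G H)
    (leftOptions◁? G H ×-dec rightOptions▷? G H ×-dec ((atomic? G ⊎-dec atomic? H) →-dec G ◁? H))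
  G ◁? H = map (◁-unfolding G H)
    (rightOptions≤? G H ⊎-dec leftOptions≥? G H ⊎-dec atomsOrdered? G H)

  leftOptions◁? [ _ ]           H = yes []
  leftOptions◁? ⟨ G ∷ Gs ∣ _ ⟩  H = all◁? G Gs H
  rightOptions▷? G [ _ ]          = yes []
  rightOptions▷? G ⟨ _ ∣ H ∷ Hs ⟩ = all▷? G H Hs
  rightOptions≤? [ _ ]          H = no λ ()
  rightOptions≤? ⟨ _ ∣ G ∷ Gs ⟩ H = any≤? G Gs H
  leftOptions≥? G [ _ ]          = no λ ()
  leftOptions≥? G ⟨ H ∷ Hs ∣ _ ⟩ = any≥? G H Hs

  all◁? G []        H = map′ (_∷ []) All.head (G ◁? H)
  all◁? G (G′ ∷ Gs) H = map′ (λ (p , ps) → p ∷ ps) All.uncons (G ◁? H ×-dec all◁? G′ Gs H)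
  all▷? G H []        = map′ (_∷ []) All.head (G ◁? H)
  all▷? G H (H′ ∷ Hs) = map′ (λ (p , ps) → p ∷ ps) All.uncons (G ◁? H ×-dec all▷? G H′ Hs)
  any≤? G []        H = map′ Any.here (Any.head λ ()) (G ≤? H)
  any≤? G (G′ ∷ Gs) H = map′ Any.fromSum Any.toSum (G ≤? H ⊎-dec any≤? G′ Gs H)
  any≥? G H []        = map′ Any.here (Any.head λ ()) (G ≤? H)
  any≥? G H (H′ ∷ Hs) = map′ Any.fromSum Any.toSum (G ≤? H ⊎-dec any≥? G H′ Hs)

  _≡G?_ : Decidable _≡G_
  G ≡G? H = G ≤? H ×-dec H ≤? G

  realizedBy : ∀ {G} n (φ : Coloring n → C) → Monotone _≼_ φ →
               {True (G ≡G? ⟦ n , φ ⟧)} → Realizable _≼_ G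
  realizedBy n φ mono {same} = n , φ , mono , toWitness same

_≤₃?_ : Decidable _≤₃_
⊥₃ ≤₃? ⊥₃ = yes refl₃
⊥₃ ≤₃? a₃ = yes ⊥≤a
⊥₃ ≤₃? ⊤₃ = yes ⊥≤⊤
a₃ ≤₃? ⊥₃ = no λ ()
a₃ ≤₃? a₃ = yes refl₃
a₃ ≤₃? ⊤₃ = yes a≤⊤
⊤₃ ≤₃? ⊥₃ = no λ ()
⊤₃ ≤₃? a₃ = no λ ()
⊤₃ ≤₃? ⊤₃ = yes refl₃

_≤₄?_ : Decidable _≤₄_
⊥₄ ≤₄? _  = yes ⊥≤
_  ≤₄? ⊤₄ = yes ≤⊤
a₄ ≤₄? ⊥₄ = no λ ()
a₄ ≤₄? a₄ = yes refl₄
a₄ ≤₄? b₄ = no λ ()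
b₄ ≤₄? ⊥₄ = no λ ()
b₄ ≤₄? a₄ = no λ ()
b₄ ≤₄? b₄ = yes refl₄
⊤₄ ≤₄? ⊥₄ = no λ ()
⊤₄ ≤₄? a₄ = no λ ()
⊤₄ ≤₄? b₄ = no λ ()

oneCell : {C : Set} → C → C → Coloring 1 → C
oneCell x y f = if f zero then x else y

oneCell-monotone : {C : Set} (_≼_ : C → C → Set) → Reflexive _≼_ →
                   ∀ {x y} → y ≼ x → Monotone _≼_ (oneCell x y)
oneCell-monotone _ refl y≼x f g f≤g with f zero | g zero | f≤g zero
... | false | false | _ = refl
... | false | true  | _ = y≼x
... | true  | true  | _ = refl

∧-mono-≤ : ∀ {x x′ y y′} → x ≤B x′ → y ≤B y′ → x ∧ y ≤B x′ ∧ y′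
∧-mono-≤ {false} _   _ = ≤-minimum _
∧-mono-≤ {true}  b≤b q = q

∨-mono-≤ : ∀ {x x′ y y′} → x ≤B x′ → y ≤B y′ → x ∨ y ≤B x′ ∨ y′
∨-mono-≤ {true}  b≤b _ = b≤b
∨-mono-≤ {false} {false} _ q = q
∨-mono-≤ {false} {true}  _ _ = ≤-maximum _

positiveDNF : {n : ℕ} → List (List (Fin n)) → Coloring n → Bool
positiveDNF clauses f = any (all f) clauses

positiveDNF-monotone : {n : ℕ} (clauses : List (List (Fin n))) → Monotone _≤B_ (positiveDNF clauses)
positiveDNF-monotone clauses f g f≤g = any-mono clauses
  where
  all-mono : ∀ cells → all f cells ≤B all g cells
  all-mono []           = b≤b
  all-mono (i ∷ cells)  = ∧-mono-≤ (f≤g i) (all-mono cells)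
  any-mono : ∀ clauses → any (all f) clauses ≤B any (all g) clauses
  any-mono []                = b≤b
  any-mono (cells ∷ clauses) = ∨-mono-≤ (all-mono cells) (any-mono clauses)

fromBits : Bool → Bool → P4
fromBits true  true  = ⊤₄
fromBits true  false = a₄
fromBits false true  = b₄
fromBits false false = ⊥₄

fromBits-mono : ∀ {x x′ y y′} → x ≤B x′ → y ≤B y′ → fromBits x y ≤₄ fromBits x′ y′
fromBits-mono {false} {y = false} _ _ = ⊥≤
fromBits-mono {x′ = true} {y′ = true} _ _ = ≤⊤
fromBits-mono {true} {true} {false} {false} b≤b b≤b = refl₄
fromBits-mono {false} {false} {true} {true} b≤b b≤b = refl₄

twoDNFs : {n : ℕ} → (as bs : List (List (Fin n))) → Coloring n → P4
twoDNFs as bs f = fromBits (positiveDNF as f) (positiveDNF bs f)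

twoDNFs-monotone : {n : ℕ} (as bs : List (List (Fin n))) → Monotone _≤₄_ (twoDNFs as bs)
twoDNFs-monotone as bs f g f≤g =
  fromBits-mono (positiveDNF-monotone as f g f≤g) (positiveDNF-monotone bs f g f≤g)

module P3-Games = GameOrderDecidable _≤₃?_
module P4-Games = GameOrderDecidable _≤₄?_

lemma3p16 : Realizable _≤₃_ gameA × Realizable _≤₃_ gameB
    × Realizable _≤₄_ gameC × Realizable _≤₄_ gameD
lemma3p16 =
    P3-Games.realizedBy 1 (oneCell ⊤₃ a₃) (oneCell-monotone _≤₃_ refl₃ a≤⊤)
  , P3-Games.realizedBy 1 (oneCell a₃ ⊥₃) (oneCell-monotone _≤₃_ refl₃ ⊥≤a)
  , P4-Games.realizedBy 2 (twoDNFs aC bC) (twoDNFs-monotone aC bC)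
  , P4-Games.realizedBy 5 (twoDNFs aD bD) (twoDNFs-monotone aD bD)
  where
  aC bC : List (List (Fin 2))
  aC = (0F ∷ []) ∷ []
  bC = (1F ∷ []) ∷ []
  aD bD : List (List (Fin 5))
  aD = (1F ∷ 2F ∷ []) ∷ (0F ∷ 2F ∷ 3F ∷ []) ∷ (0F ∷ 1F ∷ 4F ∷ []) ∷ (0F ∷ 3F ∷ 4F ∷ []) ∷ []
  bD = (2F ∷ 3F ∷ []) ∷ (1F ∷ 4F ∷ []) ∷ (2F ∷ 4F ∷ []) ∷ (3F ∷ 4F ∷ []) ∷ []
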